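{- Let $W$ be an alternate atom of LD. (1) There is no formula $Z$ of LD such that $(W\equiv\neg W)\supset(Z\bullet\sim Z)$ is a theorem of LD. (2) From $W\equiv\neg W$ one derives in LD each of $\sim W$, $\sim\neg W$, $\sim +W$ and $\sim *W$; that is, $(W\equiv\neg W)\supset U$ is a theorem of LD for each $U\in\{\sim W,\ \sim\neg W,\ \sim+W,\ \sim*W\}$.
   Context: Logic LD. Atoms: classical atoms $a,b,\dots$ and alternate atoms $\underline a,\underline b,\dots$. Formulas: least set containing the atoms and closed under $\sim X$, $\neg X$, $X\supset Y$, $X\bullet Y$, $X\cup Y$, $X\equiv Y$. Abbreviations: $+X:=\neg\sim X$ and $*X:=(\neg X\cup +X)$. Alternate formulas $\underline X$: alternate atoms or formulas $\neg Y$. Axiom schemes: Ax1.1 $X\supset(Y\supset X)$; Ax1.2 $(X\supset(Y\supset Z))\supset((X\supset Y)\supset(X\supset Z))$; Ax1.3 $X\supset(X\cup Y)$; Ax1.4 $Y\supset(X\cup Y)$; Ax1.5 $(X\supset Z)\supset((Y\supset Z)\supset((X\cup Y)\supset Z))$; Ax1.6 $(X\bullet Y)\supset X$; Ax1.7 $(X\bullet Y)\supset Y$; Ax1.8 $(X\supset Y)\supset((X\supset Z)\supset(X\supset(Y\bullet Z)))$; Ax1.9 $X\supset(\sim X\supset Y)$; Ax1.10 $X\cup\sim X$; Ax1.11 $(X\equiv Y)\supset(X\supset Y)$; Ax1.12 $(X\equiv Y)\supset(Y\supset X)$; Ax1.13 $(X\supset Y)\supset((Y\supset X)\supset(X\equiv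 Y))$; Ax2.1 $(X\supset Y)\supset(+X\supset+Y)$; Ax2.2 $\neg X\supset\sim X$; Ax2.3 $\underline X\supset+\underline X$; Ax2.4 $+A$ for every instance $A$ of Ax1.1–Ax2.3. Rule: modus ponens. Theorems: formulas derivable from the axioms. -}

module Defs where

open import Data.Nat using (ℕ)

-- Atoms are indexed by natural numbers:
-- The LD negation ¬ is written ¬ₗ (to avoid clashing with the metalevel ¬); ∼ is the other negation.
-- `cl n` is the classical atom a_n, `alt n` is the alternate atom (underlined) a_n.
infixr 4 _⊃_
infixr 5 _∪_
infixr 6 _•_
infix  3 _≣_

data Formula : Set where
  cl  : ℕ → Formula
  alt : ℕ → Formula
  ∼_  : Formula → Formula
  ¬ₗ_ : Formula → Formula
  _⊃_ : Formula → Formula → Formula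
  _•_ : Formula → Formula → Formula
  _∪_ : Formula → Formula → Formula
  _≣_ : Formula → Formula → Formula

+_ : Formula → Formula
+ X = ¬ₗ (∼ X)

*_ : Formula → Formula
* X = (¬ₗ X) ∪ (+ X)

data Alternate : Formula → Set where
  alt-atom : ∀ n → Alternate (alt n)
  alt-neg  : ∀ Y → Alternate (¬ₗ Y)

data BaseAxiom : Formula → Set where
  ax1-1  : ∀ X Y → BaseAxiom (X ⊃ (Y ⊃ X))
  ax1-2  : ∀ X Y Z → BaseAxiom ((X ⊃ (Y ⊃ Z)) ⊃ ((X ⊃ Y) ⊃ (X ⊃ Z)))
  ax1-3  : ∀ X Y → BaseAxiom (X ⊃ (X ∪ Y))
  ax1-4  : ∀ X Y → BaseAxiom (Y ⊃ (X ∪ Y))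
  ax1-5  : ∀ X Y Z → BaseAxiom ((X ⊃ Z) ⊃ ((Y ⊃ Z) ⊃ ((X ∪ Y) ⊃ Z)))
  ax1-6  : ∀ X Y → BaseAxiom ((X • Y) ⊃ X)
  ax1-7  : ∀ X Y → BaseAxiom ((X • Y) ⊃ Y)
  ax1-8  : ∀ X Y Z → BaseAxiom ((X ⊃ Y) ⊃ ((X ⊃ Z) ⊃ (X ⊃ (Y • Z))))
  ax1-9  : ∀ X Y → BaseAxiom (X ⊃ ((∼ X) ⊃ Y))
  ax1-10 : ∀ X → BaseAxiom (X ∪ (∼ X))
  ax1-11 : ∀ X Y → BaseAxiom ((X ≣ Y) ⊃ (X ⊃ Y))
  ax1-12 : ∀ X Y → BaseAxiom ((X ≣ Y) ⊃ (Y ⊃ X))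
  ax1-13 : ∀ X Y → BaseAxiom ((X ⊃ Y) ⊃ ((Y ⊃ X) ⊃ (X ≣ Y)))
  ax2-1  : ∀ X Y → BaseAxiom ((X ⊃ Y) ⊃ ((+ X) ⊃ (+ Y)))
  ax2-2  : ∀ X → BaseAxiom ((¬ₗ X) ⊃ (∼ X))
  ax2-3  : ∀ X → Alternate X → BaseAxiom (X ⊃ (+ X))

data Axiom : Formula → Set where
  base  : ∀ {A} → BaseAxiom A → Axiom A
  ax2-4 : ∀ {A} → BaseAxiom A → Axiom (+ A)

data Theorem : Formula → Set where
  axiom : ∀ {A} → Axiom A → Theorem A
  mp    : ∀ {A B} → Theorem A → Theorem (A ⊃ B) → Theorem B

{-# OPTIONS --safe #-}
module Submission where

-- Part (1) is a soundness argument for a two-valued model of LD: classical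
-- connectives are read classically, atoms are false, and ¬ₗ X is true exactly
-- when X is ∼ Y with Y true.  Then + X always has the value of X, so Ax2.1,
-- Ax2.3 and Ax2.4 collapse to classical tautologies, while the alternate atom W
-- and ¬ₗ W are both false, making W ≣ ¬ₗ W true and no Z • ∼ Z a consequence.
-- Part (2) is natural deduction: W ≣ ¬ₗ W turns W into ¬ₗ W and hence (Ax2.2)
-- into ∼ W, so W is refuted; then each of ¬ₗ W, + W and * W yields W or ∼ ∼ W,
-- and is refuted as well.

open import Defs
open import Data.Bool using (Bool; true; false; not; _∧_; _∨_; _xor_; T)
open import Data.Bool.Properties using (T-∧; ∧-inverseʳ)
open import Data.List using (List; []; _∷_)
open import Data.List.Membership.Propositional using (_∈_)
open import Data.List.Relation.Unary.Any using (here; there)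
open import Data.Nat using (ℕ)
open import Data.Product using (_×_; _,_; proj₁; proj₂)
open import Data.Unit using (tt)
open import Function.Bundles using (Equivalence)
open import Relation.Binary.PropositionalEquality using (refl; subst)
open import Relation.Nullary using (¬_)

infixr 4 _⇒_

_⇒_ : Bool → Bool → Bool
false ⇒ _ = true
true  ⇒ b = b

allBool : (Bool → Bool) → Bool
allBool f = f true ∧ f false

valid₁ : (f : Bool → Bool) → T (allBool f) → ∀ a → T (f a)
valid₁ f ok true  = proj₁ (Equivalence.to T-∧ ok)
valid₁ f ok false = proj₂ (Equivalence.to T-∧ ok)

valid₂ : (f : Bool → Bool → Bool) → T (allBool λ a → allBool (f a)) → ∀ a b → T (f a b)
valid₂ f ok a = valid₁ (f a) (valid₁ (λ a → allBool (f a)) ok a)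

valid₃ : (f : Bool → Bool → Bool → Bool) →
         T (allBool λ a → allBool λ b → allBool (f a b)) → ∀ a b c → T (f a b c)
valid₃ f ok a b = valid₁ (f a b) (valid₂ (λ a b → allBool (f a b)) ok a b)

modus-ponens : ∀ {a b} → T a → T (a ⇒ b) → T b
modus-ponens {true} _ tb = tb

⟦_⟧ : Formula → Bool
⟦ cl _ ⟧       = false
⟦ alt _ ⟧      = false
⟦ ∼ X ⟧        = not ⟦ X ⟧
⟦ ¬ₗ (∼ X) ⟧   = ⟦ X ⟧
⟦ ¬ₗ _ ⟧       = false
⟦ X ⊃ Y ⟧      = ⟦ X ⟧ ⇒ ⟦ Y ⟧
⟦ X • Y ⟧      = ⟦ X ⟧ ∧ ⟦ Y ⟧
⟦ X ∪ Y ⟧      = ⟦ X ⟧ ∨ ⟦ Y ⟧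
⟦ X ≣ Y ⟧      = not (⟦ X ⟧ xor ⟦ Y ⟧)

¬ₗ⇒∼-valid : ∀ X → T ⟦ ¬ₗ X ⊃ ∼ X ⟧
¬ₗ⇒∼-valid (∼ X)   = valid₁ (λ x → x ⇒ not (not x)) tt ⟦ X ⟧
¬ₗ⇒∼-valid (cl _)   = tt
¬ₗ⇒∼-valid (alt _)  = tt
¬ₗ⇒∼-valid (¬ₗ _)   = tt
¬ₗ⇒∼-valid (_ ⊃ _)  = tt
¬ₗ⇒∼-valid (_ • _)  = tt
¬ₗ⇒∼-valid (_ ∪ _)  = tt
¬ₗ⇒∼-valid (_ ≣ _)  = tt

-- Each `tt` is a full truth table, checked by evaluation.
baseAxiom-valid : ∀ {A} → BaseAxiom A → T ⟦ A ⟧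
baseAxiom-valid (ax1-1 X Y)   = valid₂ (λ x y → x ⇒ y ⇒ x) tt ⟦ X ⟧ ⟦ Y ⟧
baseAxiom-valid (ax1-2 X Y Z) =
  valid₃ (λ x y z → (x ⇒ y ⇒ z) ⇒ (x ⇒ y) ⇒ x ⇒ z) tt ⟦ X ⟧ ⟦ Y ⟧ ⟦ Z ⟧
baseAxiom-valid (ax1-3 X Y)   = valid₂ (λ x y → x ⇒ x ∨ y) tt ⟦ X ⟧ ⟦ Y ⟧
baseAxiom-valid (ax1-4 X Y)   = valid₂ (λ x y → y ⇒ x ∨ y) tt ⟦ X ⟧ ⟦ Y ⟧
baseAxiom-valid (ax1-5 X Y Z) =
  valid₃ (λ x y z → (x ⇒ z) ⇒ (y ⇒ z) ⇒ x ∨ y ⇒ z) tt ⟦ X ⟧ ⟦ Y ⟧ ⟦ Z ⟧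
baseAxiom-valid (ax1-6 X Y)   = valid₂ (λ x y → x ∧ y ⇒ x) tt ⟦ X ⟧ ⟦ Y ⟧
baseAxiom-valid (ax1-7 X Y)   = valid₂ (λ x y → x ∧ y ⇒ y) tt ⟦ X ⟧ ⟦ Y ⟧
baseAxiom-valid (ax1-8 X Y Z) =
  valid₃ (λ x y z → (x ⇒ y) ⇒ (x ⇒ z) ⇒ x ⇒ y ∧ z) tt ⟦ X ⟧ ⟦ Y ⟧ ⟦ Z ⟧
baseAxiom-valid (ax1-9 X Y)   = valid₂ (λ x y → x ⇒ not x ⇒ y) tt ⟦ X ⟧ ⟦ Y ⟧
baseAxiom-valid (ax1-10 X)    = valid₁ (λ x → x ∨ not x) tt ⟦ X ⟧
baseAxiom-valid (ax1-11 X Y)  = valid₂ (λ x y → not (x xor y) ⇒ x ⇒ y) tt ⟦ X ⟧ ⟦ Y ⟧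
baseAxiom-valid (ax1-12 X Y)  = valid₂ (λ x y → not (x xor y) ⇒ y ⇒ x) tt ⟦ X ⟧ ⟦ Y ⟧
baseAxiom-valid (ax1-13 X Y)  =
  valid₂ (λ x y → (x ⇒ y) ⇒ (y ⇒ x) ⇒ not (x xor y)) tt ⟦ X ⟧ ⟦ Y ⟧
baseAxiom-valid (ax2-1 X Y)   = valid₂ (λ x y → (x ⇒ y) ⇒ x ⇒ y) tt ⟦ X ⟧ ⟦ Y ⟧
baseAxiom-valid (ax2-2 X)     = ¬ₗ⇒∼-valid X
baseAxiom-valid (ax2-3 X _)   = valid₁ (λ x → x ⇒ x) tt ⟦ X ⟧

theorem-valid : ∀ {A} → Theorem A → T ⟦ A ⟧
theorem-valid (axiom (base a))  = baseAxiom-valid a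
theorem-valid (axiom (ax2-4 a)) = baseAxiom-valid a
theorem-valid (mp d e)          = modus-ponens (theorem-valid d) (theorem-valid e)

contradiction-invalid : ∀ Z → ¬ T ⟦ Z • ∼ Z ⟧
contradiction-invalid Z = subst T (∧-inverseʳ ⟦ Z ⟧)

true⇒¬⊢⊃contradiction : ∀ {H} → T ⟦ H ⟧ → ∀ Z → ¬ Theorem (H ⊃ Z • ∼ Z)
true⇒¬⊢⊃contradiction h Z t = contradiction-invalid Z (modus-ponens h (theorem-valid t))

infix 2 _⊢_

data _⊢_ (Γ : List Formula) : Formula → Set where
  hyp : ∀ {A} → A ∈ Γ → Γ ⊢ A
  ax  : ∀ {A} → BaseAxiom A → Γ ⊢ A
  ⊢mp : ∀ {A B} → Γ ⊢ A → Γ ⊢ A ⊃ B → Γ ⊢ B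

module _ {Γ : List Formula} where

  weaken : ∀ {A B} → Γ ⊢ A → B ∷ Γ ⊢ A
  weaken (hyp p)   = hyp (there p)
  weaken (ax a)    = ax a
  weaken (⊢mp d e) = ⊢mp (weaken d) (weaken e)

  ⊃-refl : ∀ A → Γ ⊢ A ⊃ A
  ⊃-refl A = ⊢mp (ax (ax1-1 A A)) (⊢mp (ax (ax1-1 A (A ⊃ A))) (ax (ax1-2 A (A ⊃ A) A)))

  deduction : ∀ {A B} → A ∷ Γ ⊢ B → Γ ⊢ A ⊃ B
  deduction {A} (hyp (here refl)) = ⊃-refl A
  deduction {A} (hyp (there p))   = ⊢mp (hyp p) (ax (ax1-1 _ A))
  deduction {A} (ax a)            = ⊢mp (ax a) (ax (ax1-1 _ A))
  deduction {A} (⊢mp {B} {C} d e) = ⊢mp (deduction d) (⊢mp (deduction e) (ax (ax1-2 A B C)))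

  ∪-elim : ∀ {X Y Z} → X ∷ Γ ⊢ Z → Y ∷ Γ ⊢ Z → Γ ⊢ X ∪ Y → Γ ⊢ Z
  ∪-elim {X} {Y} {Z} d e x∪y =
    ⊢mp x∪y (⊢mp (deduction e) (⊢mp (deduction d) (ax (ax1-5 X Y Z))))

  ∼-intro : ∀ {X} → X ∷ Γ ⊢ ∼ X → Γ ⊢ ∼ X
  ∼-intro {X} d = ∪-elim d (hyp (here refl)) (ax (ax1-10 X))

  explosion : ∀ {X Y} → Γ ⊢ X → Γ ⊢ ∼ X → Γ ⊢ Y
  explosion {X} {Y} x ∼x = ⊢mp ∼x (⊢mp x (ax (ax1-9 X Y)))

closed⇒theorem : ∀ {A} → [] ⊢ A → Theorem A
closed⇒theorem (ax a)    = axiom (base a)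
closed⇒theorem (⊢mp d e) = mp (closed⇒theorem d) (closed⇒theorem e)

refutation⇒theorem : ∀ {H U} → (∀ {Γ} → Γ ⊢ H → Γ ⊢ U → Γ ⊢ ∼ U) → Theorem (H ⊃ ∼ U)
refutation⇒theorem refute =
  closed⇒theorem (deduction (∼-intro (refute (weaken (hyp (here refl))) (hyp (here refl)))))

Liar : Formula → Formula
Liar W = W ≣ ¬ₗ W

module _ {W : Formula} where

  liar-W⇒∼W : ∀ {Γ} → Γ ⊢ Liar W → Γ ⊢ W → Γ ⊢ ∼ W
  liar-W⇒∼W liar w = ⊢mp (⊢mp w (⊢mp liar (ax (ax1-11 W (¬ₗ W))))) (ax (ax2-2 W))

  liar⇒∼W : ∀ {Γ} → Γ ⊢ Liar W → Γ ⊢ ∼ W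
  liar⇒∼W liar = ∼-intro (liar-W⇒∼W (weaken liar) (hyp (here refl)))

  liar-¬W⇒any : ∀ {Γ Y} → Γ ⊢ Liar W → Γ ⊢ ¬ₗ W → Γ ⊢ Y
  liar-¬W⇒any liar ¬w = explosion (⊢mp ¬w (⊢mp liar (ax (ax1-12 W (¬ₗ W))))) (liar⇒∼W liar)

  liar-+W⇒any : ∀ {Γ Y} → Γ ⊢ Liar W → Γ ⊢ + W → Γ ⊢ Y
  liar-+W⇒any liar +w = explosion (liar⇒∼W liar) (⊢mp +w (ax (ax2-2 (∼ W))))

  liar-*W⇒any : ∀ {Γ Y} → Γ ⊢ Liar W → Γ ⊢ * W → Γ ⊢ Y
  liar-*W⇒any liar = ∪-elim (liar-¬W⇒any (weaken liar) (hyp (here refl)))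
                            (liar-+W⇒any (weaken liar) (hyp (here refl)))

mainTheorem15 : (n : ℕ) →
    ((Z : Formula) → ¬ Theorem (((alt n) ≣ (¬ₗ (alt n))) ⊃ (Z • (∼ Z))))
    × (Theorem (((alt n) ≣ (¬ₗ (alt n))) ⊃ (∼ (alt n)))
    × Theorem (((alt n) ≣ (¬ₗ (alt n))) ⊃ (∼ (¬ₗ (alt n))))
    × Theorem (((alt n) ≣ (¬ₗ (alt n))) ⊃ (∼ (+ (alt n))))
    × Theorem (((alt n) ≣ (¬ₗ (alt n))) ⊃ (∼ (* (alt n)))))
mainTheorem15 n =
    true⇒¬⊢⊃contradiction tt
  , refutation⇒theorem liar-W⇒∼W
  , refutation⇒theorem liar-¬W⇒any
  , refutation⇒theorem liar-+W⇒any
  , refutation⇒theorem liar-*W⇒any
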